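{- Let $\mathcal{G}=(X,\mathcal{F},P)$ be a Maker-Breaker poset positional game where $P$ is made of pairwise disjoint chains, with Maker starting. If $\{u\}\in\mathcal{F}$ for some white vertex $u$, then Maker has a winning strategy.
   Context: A poset positional game is a triple $(X,\mathcal{F},P)$ with $X$ a finite board of vertices, $\mathcal{F}\subseteq 2^X$ the winning sets, and $P$ a partial order on $X$. Two players alternately claim an unclaimed vertex $v$ such that all vertices smaller than $v$ in $P$ are already claimed, until all vertices are claimed. In the Maker-Breaker convention, Maker wins if she claims all vertices of some winning set; otherwise Breaker wins. $P$ is made of pairwise disjoint chains $C_1,\dots,C_w$ (partitioning $X$, elements of distinct chains incomparable); the elements of $C_i$ are written $x_{i,1}>x_{i,2}>\dots>x_{i,\ell_i}$ (numbered from top to bottom). The vertex $x_{i,j}$ is colored white if $j$ has the same parity as $|X|$, and black otherwise. -}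

module Defs where

open import Data.Nat using (ℕ; zero; suc; _+_; _<_; _%_)
open import Data.Fin using (Fin; toℕ; _≟_)
open import Data.List using (List; []; _∷_; _++_; length; filter; map; allFin)
open import Data.Nat.ListAction using (sum)
open import Data.List.Membership.Propositional using (_∈_)
open import Data.Product using (Σ; ∃; ∃-syntax; _×_; _,_; proj₁; proj₂)
open import Relation.Binary.PropositionalEquality using (_≡_)
open import Relation.Nullary using (¬_)

-- A poset made of w pairwise disjoint chains; chain i has ℓ i elements
-- x_{i,1} > x_{i,2} > ... > x_{i,ℓ i}.
-- The vertex x_{i,j+1} is represented by (i , j) with j : Fin (ℓ i).
Vertex : (w : ℕ) → (Fin w → ℕ) → Set
Vertex w ℓ = Σ (Fin w) (λ i → Fin (ℓ i))

boardSize : (w : ℕ) → (Fin w → ℕ) → ℕ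
boardSize w ℓ = sum (map ℓ (allFin w))

-- x_{i,j} is white iff j ≡ |X| (mod 2)   (1-based j = toℕ j + 1)
White : (w : ℕ) (ℓ : Fin w → ℕ) → Vertex w ℓ → Set
White w ℓ (i , j) = suc (toℕ j) % 2 ≡ boardSize w ℓ % 2

module Game (w : ℕ) (ℓ : Fin w → ℕ) (F : List (List (Vertex w ℓ))) where

  -- A history is the chronological list of chains on which a vertex was claimed.
  -- Since a vertex can only be claimed when all smaller ones are claimed,
  -- a move on chain i claims the lowest unclaimed vertex x_{i, ℓ i - c}
  -- where c is the number of earlier moves on chain i.
  History : Set
  History = List (Fin w)

  count : Fin w → History → ℕ
  count i h = length (filter (_≟ i) h)

  Legal : History → Fin w → Set
  Legal h i = count i h < ℓ i

  MakerTurn : History → Set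
  MakerTurn h = length h % 2 ≡ 0

  BreakerTurn : History → Set
  BreakerTurn h = length h % 2 ≡ 1

  MakerOwns : History → Vertex w ℓ → Set
  MakerOwns h (i , j) =
    ∃[ h₁ ] ∃[ h₂ ] (h ≡ h₁ ++ (i ∷ h₂)) × MakerTurn h₁
                    × (count i h₁ + suc (toℕ j) ≡ ℓ i)

  MakerWon : History → Set
  MakerWon h = ∃[ S ] (S ∈ F) × (∀ v → v ∈ S → MakerOwns h v)

  data MakerWins (h : History) : Set where
    finished    : (∀ i → ¬ Legal h i) → MakerWon h → MakerWins h
    makerMove   : MakerTurn h → (i : Fin w) → Legal h i
                → MakerWins (h ++ (i ∷ [])) → MakerWins h
    breakerMove : BreakerTurn h → (∃[ i ] Legal h i)
                → (∀ i → Legal h i → MakerWins (h ++ (i ∷ []))) → MakerWins h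

  MakerHasWinningStrategy : Set
  MakerHasWinningStrategy = MakerWins []

-- Maker only needs to claim the white vertex u.  She plays on other chains while she can, which
-- never brings u to the bottom of its chain; when only u's chain is left, the board parity
-- (|X| minus the number of moves made so far equals the number of remaining moves) guarantees
-- that her own move there cannot leave u exposed to Breaker.  So u is never claimable on Breaker's
-- turn, and Maker takes it as soon as it becomes claimable; afterwards any play wins.
module Submission where

open import Defs
open import Data.Nat using (ℕ; zero; suc; _+_; _∸_; _<_; _≤_; _%_; z<s; s≤s; _<?_)
  renaming (_≟_ to _≟ℕ_)
open import Data.Nat.Properties hiding (_≟_)
open import Data.Nat.DivMod using (%-distribˡ-+; m%n<n; %-remove-+ˡ)
open import Data.Nat.Divisibility using (m%n≡0⇒n∣m)
import Data.Nat.ListAction as ListAction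
open import Algebra.Properties.CommutativeMonoid.Sum +-0-commutativeMonoid
  using (sum; sum-remove; sum-cong-≗; sum-replicate-zero)
open import Data.Fin using (Fin; toℕ; _≟_; punchIn) renaming (zero to fzero; suc to fsuc)
open import Data.Fin.Properties using (any?; toℕ<n; punchInᵢ≢i)
open import Data.Vec.Functional using (Vector)
open import Data.List using (List; []; _∷_; [_]; _∷ʳ_; length; filter; tabulate)
open import Data.List.Properties
  using (length-++; filter-++; filter-accept; filter-reject; map-tabulate; ++-assoc)
open import Data.List.Membership.Propositional using (_∈_)
open import Data.List.Relation.Unary.Any using (here)
open import Data.Product using (_,_)
open import Data.Sum using (_⊎_; inj₁; inj₂)
open import Function using (id; _∘_)
open import Relation.Nullary using (¬_; Dec; yes; no; ¬?; contradiction)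
open import Relation.Nullary.Decidable using (_×-dec_)
open import Relation.Binary.PropositionalEquality
  using (_≡_; _≢_; refl; sym; trans; cong; cong₂; subst; module ≡-Reasoning)

open ≡-Reasoning

sum-tabulate : ∀ {n} (f : Vector ℕ n) → ListAction.sum (tabulate f) ≡ sum f
sum-tabulate {zero}  f = refl
sum-tabulate {suc n} f = cong (f fzero +_) (sum-tabulate (f ∘ fsuc))

boardSize≡sum : ∀ w (ℓ : Fin w → ℕ) → boardSize w ℓ ≡ sum ℓ
boardSize≡sum w ℓ = trans (cong ListAction.sum (map-tabulate id ℓ)) (sum-tabulate ℓ)

sum-suc-at : ∀ {n} (f g : Vector ℕ n) (k : Fin n) →
             f k ≡ suc (g k) → (∀ i → i ≢ k → f i ≡ g i) → sum f ≡ suc (sum g)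
sum-suc-at {suc n} f g k fk≡1+gk f≡g = begin
  sum f                            ≡⟨ sum-remove {i = k} f ⟩
  f k + sum (f ∘ punchIn k)        ≡⟨ cong₂ _+_ fk≡1+gk (sum-cong-≗ (λ i → f≡g _ (punchInᵢ≢i k i))) ⟩
  suc (g k + sum (g ∘ punchIn k))  ≡⟨ cong suc (sum-remove {i = k} g) ⟨
  suc (sum g)                      ∎

sum-supported-at : ∀ {n} (f : Vector ℕ n) (k : Fin n) → (∀ i → i ≢ k → f i ≡ 0) → sum f ≡ f k
sum-supported-at {suc n} f k f≡0 = begin
  sum f                     ≡⟨ sum-remove {i = k} f ⟩
  f k + sum (f ∘ punchIn k) ≡⟨ cong (f k +_) (sum-cong-≗ (λ i → f≡0 _ (punchInᵢ≢i k i))) ⟩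
  f k + sum {n} (λ _ → 0)   ≡⟨ cong (f k +_) (sum-replicate-zero n) ⟩
  f k + 0                   ≡⟨ +-identityʳ (f k) ⟩
  f k                       ∎

length-∷ʳ : ∀ {A : Set} (xs : List A) x → length (xs ∷ʳ x) ≡ suc (length xs)
length-∷ʳ xs x = trans (length-++ xs) (+-comm (length xs) 1)

suc-%2 : ∀ n → suc n % 2 ≡ (1 + n % 2) % 2
suc-%2 n = %-distribˡ-+ 1 n 2

even⇒suc-odd : ∀ n → n % 2 ≡ 0 → suc n % 2 ≡ 1
even⇒suc-odd n n%2≡0 = trans (suc-%2 n) (cong (λ r → (1 + r) % 2) n%2≡0)

odd⇒suc-even : ∀ n → n % 2 ≡ 1 → suc n % 2 ≡ 0
odd⇒suc-even n n%2≡1 = trans (suc-%2 n) (cong (λ r → (1 + r) % 2) n%2≡1)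

%2-even⊎odd : ∀ n → n % 2 ≡ 0 ⊎ n % 2 ≡ 1
%2-even⊎odd n with n % 2 | m%n<n n 2
... | 0 | _ = inj₁ refl
... | 1 | _ = inj₂ refl
... | suc (suc _) | s≤s (s≤s ())

suc-%2-≢ : ∀ n → suc n % 2 ≢ n % 2
suc-%2-≢ n eq with %2-even⊎odd n
... | inj₁ even = 0≢1+n (trans (sym even) (trans (sym eq) (even⇒suc-odd n even)))
... | inj₂ odd  = 0≢1+n (trans (sym (odd⇒suc-even n odd)) (trans eq odd))

even+suc-%2-≢ : ∀ m n → m % 2 ≡ 0 → (m + suc n) % 2 ≢ n % 2
even+suc-%2-≢ m n m%2≡0 =
  subst (_≢ n % 2) (sym (%-remove-+ˡ (suc n) (m%n≡0⇒n∣m m 2 m%2≡0))) (suc-%2-≢ n)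

module GameProperties (w : ℕ) (ℓ : Fin w → ℕ) (F : List (List (Vertex w ℓ))) where
  open Game w ℓ F

  count-∷ʳ : ∀ h x i → count i (h ∷ʳ x) ≡ count i h + count i [ x ]
  count-∷ʳ h x i = trans (cong length (filter-++ (_≟ i) h [ x ])) (length-++ (filter (_≟ i) h))

  count-∷ʳ-self : ∀ h i → count i (h ∷ʳ i) ≡ suc (count i h)
  count-∷ʳ-self h i = begin
    count i (h ∷ʳ i)           ≡⟨ count-∷ʳ h i i ⟩
    count i h + count i [ i ]  ≡⟨ cong (λ xs → count i h + length xs) (filter-accept (_≟ i) refl) ⟩
    count i h + 1              ≡⟨ +-comm (count i h) 1 ⟩
    suc (count i h)            ∎

  count-∷ʳ-other : ∀ h {x i} → x ≢ i → count i (h ∷ʳ x) ≡ count i h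
  count-∷ʳ-other h {x} {i} x≢i = begin
    count i (h ∷ʳ x)           ≡⟨ count-∷ʳ h x i ⟩
    count i h + count i [ x ]  ≡⟨ cong (λ xs → count i h + length xs) (filter-reject (_≟ i) x≢i) ⟩
    count i h + 0              ≡⟨ +-identityʳ (count i h) ⟩
    count i h                  ∎

  count-∷ʳ-≤ : ∀ h x i → count i (h ∷ʳ x) ≤ suc (count i h)
  count-∷ʳ-≤ h x i with x ≟ i
  ... | yes refl = ≤-reflexive (count-∷ʳ-self h i)
  ... | no x≢i   = ≤-trans (≤-reflexive (count-∷ʳ-other h x≢i)) (n≤1+n (count i h))

  Legal? : ∀ h i → Dec (Legal h i)
  Legal? h i = count i h <? ℓ i

  makerTurn-∷ʳ : ∀ h x → MakerTurn h → BreakerTurn (h ∷ʳ x)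
  makerTurn-∷ʳ h x mt = trans (cong (_% 2) (length-∷ʳ h x)) (even⇒suc-odd (length h) mt)

  breakerTurn-∷ʳ : ∀ h x → BreakerTurn h → MakerTurn (h ∷ʳ x)
  breakerTurn-∷ʳ h x bt = trans (cong (_% 2) (length-∷ʳ h x)) (odd⇒suc-even (length h) bt)

  remaining : History → ℕ
  remaining h = sum (λ i → ℓ i ∸ count i h)

  remaining-∷ʳ : ∀ h {i} → Legal h i → remaining h ≡ suc (remaining (h ∷ʳ i))
  remaining-∷ʳ h {i} legal =
    sum-suc-at _ _ i ℓ∸count≡ (λ x x≢i → cong (ℓ x ∸_) (sym (count-∷ʳ-other h (x≢i ∘ sym))))
    where
    ℓ∸count≡ : ℓ i ∸ count i h ≡ suc (ℓ i ∸ count i (h ∷ʳ i))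
    ℓ∸count≡ = begin
      ℓ i ∸ count i h               ≡⟨ +-∸-assoc 1 legal ⟩
      suc (ℓ i ∸ suc (count i h))   ≡⟨ cong (λ c → suc (ℓ i ∸ c)) (count-∷ʳ-self h i) ⟨
      suc (ℓ i ∸ count i (h ∷ʳ i))  ∎

  remaining-∷ʳ-pred : ∀ h {i n} → remaining h ≡ suc n → Legal h i → remaining (h ∷ʳ i) ≡ n
  remaining-∷ʳ-pred h r≡1+n legal = suc-injective (trans (sym (remaining-∷ʳ h legal)) r≡1+n)

  remaining≡0⇒¬Legal : ∀ h i → remaining h ≡ 0 → ¬ Legal h i
  remaining≡0⇒¬Legal h i r≡0 legal = 0≢1+n (trans (sym r≡0) (remaining-∷ʳ h legal))

  remaining-only-chain : ∀ h i₀ → (∀ i → i ≢ i₀ → ¬ Legal h i) → remaining h ≡ ℓ i₀ ∸ count i₀ h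
  remaining-only-chain h i₀ ¬legal =
    sum-supported-at _ i₀ (λ i i≢i₀ → m≤n⇒m∸n≡0 (≮⇒≥ (¬legal i i≢i₀)))

  length+remaining-∷ʳ : ∀ h {i} → Legal h i →
                        length (h ∷ʳ i) + remaining (h ∷ʳ i) ≡ length h + remaining h
  length+remaining-∷ʳ h {i} legal = begin
    length (h ∷ʳ i) + remaining (h ∷ʳ i)   ≡⟨ cong (_+ remaining (h ∷ʳ i)) (length-∷ʳ h i) ⟩
    suc (length h) + remaining (h ∷ʳ i)    ≡⟨ +-suc (length h) _ ⟨
    length h + suc (remaining (h ∷ʳ i))    ≡⟨ cong (length h +_) (remaining-∷ʳ h legal) ⟨
    length h + remaining h                 ∎

  MakerOwns-∷ʳ : ∀ h x v → MakerOwns h v → MakerOwns (h ∷ʳ x) v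
  MakerOwns-∷ʳ h x (i , _) (h₁ , h₂ , h≡ , mt , claimed) =
    h₁ , h₂ ∷ʳ x , trans (cong (_∷ʳ x) h≡) (++-assoc h₁ (i ∷ h₂) [ x ]) , mt , claimed

  MakerWon-∷ʳ : ∀ h x → MakerWon h → MakerWon (h ∷ʳ x)
  MakerWon-∷ʳ h x (S , S∈F , owns) = S , S∈F , λ v v∈S → MakerOwns-∷ʳ h x v (owns v v∈S)

  makerWon⇒makerWins : ∀ h → MakerWon h → MakerWins h
  makerWon⇒makerWins h = go _ h refl
    where
    go : ∀ n h → remaining h ≡ n → MakerWon h → MakerWins h
    go zero    h r≡0   won = finished (λ i → remaining≡0⇒¬Legal h i r≡0) won
    go (suc n) h r≡1+n won with any? (Legal? h)
    ... | no ¬legal = finished (λ i legal → ¬legal (i , legal)) won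
    ... | yes (i , legal) with %2-even⊎odd (length h)
    ...   | inj₁ mt = makerMove mt i legal (go n _ (remaining-∷ʳ-pred h r≡1+n legal) (MakerWon-∷ʳ h i won))
    ...   | inj₂ bt = breakerMove bt (i , legal) λ i′ legal′ →
                        go n _ (remaining-∷ʳ-pred h r≡1+n legal′) (MakerWon-∷ʳ h i′ won)

  module SingletonWhiteStrategy (i₀ : Fin w) (j : Fin (ℓ i₀))
                                (white : White w ℓ (i₀ , j)) (u∈F : ((i₀ , j) ∷ []) ∈ F) where

    -- u = (i₀ , j) is x_{i₀,k}: it is claimed by the move on chain i₀ made when count i₀ h + k ≡ ℓ i₀.
    k : ℕ
    k = suc (toℕ j)

    Tally : History → Set
    Tally h = length h + remaining h ≡ boardSize w ℓ

    Tally-∷ʳ : ∀ h {i} → Legal h i → Tally h → Tally (h ∷ʳ i)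
    Tally-∷ʳ h legal tally = trans (length+remaining-∷ʳ h legal) tally

    unclaimed⇒legal : ∀ h → count i₀ h + k ≤ ℓ i₀ → Legal h i₀
    unclaimed⇒legal h unclaimed = <-≤-trans (m<m+n (count i₀ h) z<s) unclaimed

    last-chain-move-keeps-u : ∀ h → MakerTurn h → Tally h → (∀ i → i ≢ i₀ → ¬ Legal h i) →
                              suc (count i₀ h + k) ≢ ℓ i₀
    last-chain-move-keeps-u h mt tally only-i₀ exposed = even+suc-%2-≢ (length h) k mt (begin
      (length h + suc k) % 2        ≡⟨ cong (λ r → (length h + r) % 2) remaining≡1+k ⟨
      (length h + remaining h) % 2  ≡⟨ cong (_% 2) tally ⟩
      boardSize w ℓ % 2             ≡⟨ white ⟨
      k % 2                         ∎)
      where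
      c : ℕ
      c = count i₀ h
      remaining≡1+k : remaining h ≡ suc k
      remaining≡1+k = begin
        remaining h          ≡⟨ remaining-only-chain h i₀ only-i₀ ⟩
        ℓ i₀ ∸ c             ≡⟨ cong (_∸ c) exposed ⟨
        suc (c + k) ∸ c      ≡⟨ cong (_∸ c) (+-suc c k) ⟨
        c + suc k ∸ c        ≡⟨ m+n∸m≡n c (suc k) ⟩
        suc k                ∎

    makerToMove   : ∀ n h → remaining h ≡ n → Tally h → MakerTurn h →
                    count i₀ h + k ≤ ℓ i₀ → MakerWins h
    breakerToMove : ∀ n h → remaining h ≡ n → Tally h → BreakerTurn h →
                    count i₀ h + k < ℓ i₀ → MakerWins h

    makerToMove zero h r≡0 _ _ unclaimed =
      contradiction (unclaimed⇒legal h unclaimed) (remaining≡0⇒¬Legal h i₀ r≡0)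
    makerToMove (suc n) h r≡1+n tally mt unclaimed with count i₀ h + k ≟ℕ ℓ i₀
    ... | yes claimable =
      makerMove mt i₀ (unclaimed⇒legal h unclaimed) (makerWon⇒makerWins _ won)
      where
      won : MakerWon (h ∷ʳ i₀)
      won = (i₀ , j) ∷ [] , u∈F , λ { _ (here refl) → h , [] , refl , mt , claimable }
    ... | no unclaimable with any? (λ i → ¬? (i ≟ i₀) ×-dec Legal? h i)
    ...   | yes (i , i≢i₀ , legal) =
      makerMove mt i legal
        (breakerToMove n (h ∷ʳ i) (remaining-∷ʳ-pred h r≡1+n legal) (Tally-∷ʳ h legal tally)
          (makerTurn-∷ʳ h i mt)
          (subst (λ c → c + k < ℓ i₀) (sym (count-∷ʳ-other h i≢i₀)) (≤∧≢⇒< unclaimed unclaimable)))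
    ...   | no no-other-move =
      makerMove mt i₀ legal
        (breakerToMove n (h ∷ʳ i₀) (remaining-∷ʳ-pred h r≡1+n legal) (Tally-∷ʳ h legal tally)
          (makerTurn-∷ʳ h i₀ mt)
          (subst (λ c → c + k < ℓ i₀) (sym (count-∷ʳ-self h i₀))
            (≤∧≢⇒< (≤∧≢⇒< unclaimed unclaimable)
                   (last-chain-move-keeps-u h mt tally
                      (λ i i≢i₀ legal′ → no-other-move (i , i≢i₀ , legal′))))))
      where
      legal : Legal h i₀
      legal = unclaimed⇒legal h unclaimed

    breakerToMove zero h r≡0 _ _ free =
      contradiction (unclaimed⇒legal h (<⇒≤ free)) (remaining≡0⇒¬Legal h i₀ r≡0)
    breakerToMove (suc n) h r≡1+n tally bt free =
      breakerMove bt (i₀ , unclaimed⇒legal h (<⇒≤ free)) λ i legal →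
        makerToMove n (h ∷ʳ i) (remaining-∷ʳ-pred h r≡1+n legal) (Tally-∷ʳ h legal tally)
          (breakerTurn-∷ʳ h i bt) (≤-trans (+-monoˡ-≤ k (count-∷ʳ-≤ h i i₀)) free)

lemma3 : (w : ℕ) (ℓ : Fin w → ℕ) → (∀ i → 0 < ℓ i)
       → (F : List (List (Vertex w ℓ)))
       → (u : Vertex w ℓ) → White w ℓ u → (u ∷ []) ∈ F
       → Game.MakerHasWinningStrategy w ℓ F
lemma3 w ℓ _ F (i₀ , j) white u∈F =
  makerToMove _ [] refl (sym (boardSize≡sum w ℓ)) refl (toℕ<n j)
  where open GameProperties.SingletonWhiteStrategy w ℓ F i₀ j white u∈F
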